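{- For every positive integer $n$, $$\sum_{\pi} q^{i(\pi)}=(1+q)(1+q^2)\cdots(1+q^{n-1}),$$ where the sum runs over all valleyless permutations $\pi$ of $\{1,\ldots,n\}$.
   Context: For a permutation $\pi=\pi_1\ldots\pi_n$ of $\{1,\ldots,n\}$, $i(\pi)$ denotes its number of inversions, i.e. $i(\pi)=a_1+\cdots+a_n$ where $a_k$ is the number of entries to the left of $k$ in $\pi$ that are greater than $k$ (equivalently, the number of pairs $i<j$ with $\pi_i>\pi_j$). A sequence $s_1,\ldots,s_n$ is valleyless if for all $1\le i<j<k\le n$ one has $s_j\ge\min\{s_i,s_k\}$. $q$ is a formal variable. -}

module Defs where

open import Data.Nat using (ℕ; zero; suc; _+_; _*_; _⊓_; _≤ᵇ_; _<ᵇ_; _≡ᵇ_)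
open import Data.Bool using (Bool; true; false; _∧_; if_then_else_)
open import Data.List using (List; []; _∷_; map; filter; concatMap; length; foldr; replicate; _++_)
open import Data.Bool using (T)
open import Data.Bool.ListAction using (all; any)

-- Polynomials in q with natural-number coefficients, as coefficient
-- lists (constant term first).  Equality of polynomials is
-- coefficientwise equality, via `coeff`.

Poly : Set
Poly = List ℕ

addP : Poly → Poly → Poly
addP [] q = q
addP (a ∷ p) [] = a ∷ p
addP (a ∷ p) (b ∷ q) = (a + b) ∷ addP p q

mulP : Poly → Poly → Poly
mulP [] q = []
mulP (a ∷ p) q = addP (map (a *_) q) (0 ∷ mulP p q)

coeff : ℕ → Poly → ℕ
coeff k [] = 0
coeff zero (a ∷ p) = a
coeff (suc k) (a ∷ p) = coeff k p

oneP : Poly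
oneP = 1 ∷ []

qPow : ℕ → Poly
qPow k = replicate k 0 ++ (1 ∷ [])

sumP : List Poly → Poly
sumP = foldr addP []

prodP : List Poly → Poly
prodP = foldr mulP oneP

range : ℕ → ℕ → List ℕ
range a zero = []
range a (suc m) = a ∷ range (suc a) m

seqs : ℕ → List ℕ → List (List ℕ)
seqs zero xs = [] ∷ []
seqs (suc len) xs = concatMap (λ x → map (x ∷_) (seqs len xs)) xs

elemᵇ : ℕ → List ℕ → Bool
elemᵇ k xs = any (k ≡ᵇ_) xs

-- a length-n sequence with entries in {1..n} is a permutation of {1..n}
-- iff every k ∈ {1..n} occurs in it
coversᵇ : ℕ → List ℕ → Bool
coversᵇ n π = all (λ k → elemᵇ k π) (range 1 n)

perms : ℕ → List (List ℕ)
perms n = filter (λ π → T? (coversᵇ n π)) (seqs n (range 1 n))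
  where
  open import Relation.Nullary.Decidable using (Dec)
  open import Data.Bool.Properties using (T?)

countᵇ : (ℕ → Bool) → List ℕ → ℕ
countᵇ p [] = 0
countᵇ p (x ∷ xs) = if p x then suc (countᵇ p xs) else countᵇ p xs

inv : List ℕ → ℕ
inv [] = 0
inv (x ∷ xs) = countᵇ (λ y → y <ᵇ x) xs + inv xs

-- valleyless: for all i < j < k, s_j ≥ min(s_i, s_k)
-- noValleyFrom x ys : for all j < k positions in ys, ys_j ≥ min(x, ys_k)
noValleyFrom : ℕ → List ℕ → Bool
noValleyFrom x [] = true
noValleyFrom x (y ∷ zs) = all (λ z → (x ⊓ z) ≤ᵇ y) zs ∧ noValleyFrom x zs

valleylessᵇ : List ℕ → Bool
valleylessᵇ [] = true
valleylessᵇ (x ∷ xs) = noValleyFrom x xs ∧ valleylessᵇ xs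

Valleyless : List ℕ → Set
Valleyless s = T (valleylessᵇ s)

valleylessPerms : ℕ → List (List ℕ)
valleylessPerms n = filter (λ π → T? (valleylessᵇ π)) (perms n)
  where
  open import Data.Bool.Properties using (T?)

lhsPoly : ℕ → Poly
lhsPoly n = sumP (map (λ π → qPow (inv π)) (valleylessPerms n))

rhsPoly : ℕ → Poly
rhsPoly n = prodP (map (λ j → addP oneP (qPow j)) (range 1 (n Data.Nat.∸ 1)))
  where import Data.Nat

-- In a valleyless permutation of {1, …, n} the entry 1 cannot stand between two
-- other entries, since together with any entry on each side it would form a
-- valley; so 1 comes first or last.  Deleting it and lowering the remaining
-- entries by one gives a valleyless permutation of {1, …, n - 1}, and every such
-- permutation arises exactly once from each end.  A leading 1 creates no
-- inversion and a trailing 1 creates n - 1 of them, so the left-hand side is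
-- multiplied by 1 + q^(n-1) from n - 1 to n; the right-hand side satisfies the
-- same recursion because its factors commute.

module Submission where

open import Defs
open import Data.Bool using (Bool; true; false; T; _∧_)
open import Data.Bool.ListAction using (all; and)
open import Data.Bool.Properties using (T?; T-∧; T-≡)
open import Data.Empty using (⊥-elim)
open import Data.List using (List; []; _∷_; _++_; _∷ʳ_; map; length; concatMap; cartesianProductWith)
open import Data.List.Properties using (∷-injective; ∷-injectiveˡ; ∷-injectiveʳ; ∷ʳ-injectiveˡ; map-injective; map-++; map-∘; map-cong; length-map; ++-identityʳ)
open import Data.List.Membership.Propositional using (_∈_)
open import Data.List.Membership.Propositional.Properties using (∈-∃++; ∈-map⁺; ∈-map⁻; ∈-++⁺ˡ; ∈-++⁺ʳ; ∈-++⁻; ∈-filter⁺; ∈-filter⁻; ∈-cartesianProductWith⁺; ∈-cartesianProductWith⁻)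
open import Data.List.Membership.Propositional.Properties.WithK using (unique∧set⇒bag)
open import Data.List.Relation.Binary.BagAndSetEquality using (∼bag⇒↭)
open import Data.List.Relation.Binary.Disjoint.Propositional using (Disjoint)
open import Data.List.Relation.Binary.Permutation.Propositional using (_↭_; ↭-refl; ↭-sym; ↭-trans; ↭-prep)
import Data.List.Relation.Binary.Permutation.Propositional.Properties as ↭
open import Data.List.Relation.Binary.Subset.Propositional using (_⊆_)
open import Data.List.Relation.Unary.All as All using (All; []; _∷_)
import Data.List.Relation.Unary.All.Properties as Allₚ
open import Data.List.Relation.Unary.AllPairs using ([]; _∷_)
open import Data.List.Relation.Unary.Any as Any using (here; there)
open import Data.List.Relation.Unary.Any.Properties using (any⁺; any⁻)
open import Data.List.Relation.Unary.Unique.Propositional using (Unique)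
import Data.List.Relation.Unary.Unique.Propositional.Properties as Unique
open import Data.Nat using (ℕ; zero; suc; _+_; _*_; _⊓_; _≤_; _<_; _≤ᵇ_; _<ᵇ_; _≡ᵇ_; z≤n; s≤s; s≤s⁻¹)
open import Data.Nat.ListAction using (sum)
open import Data.Nat.ListAction.Properties using (sum-++; sum-↭)
open import Data.Nat.Properties using (+-comm; +-suc; +-identityʳ; *-identityˡ; *-zeroʳ; +-commutativeSemigroup; ≤-refl; ≤-trans; ≤-reflexive; <⇒≤; <⇒≢; <⇒≱; 1+n≰n; 0≢1+n; suc-injective; m⊓n≤m; m⊓n≤n; ⊓-glb; ≤⇒≤ᵇ; ≤ᵇ⇒≤; <⇒<ᵇ; <ᵇ⇒<; ≡ᵇ⇒≡; ≡⇒≡ᵇ)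
open import Algebra.Properties.CommutativeSemigroup +-commutativeSemigroup using (interchange; x∙yz≈y∙xz)
open import Data.Product using (∃-syntax; _×_; _,_; proj₁; proj₂)
open import Data.Sum using (_⊎_; inj₁; inj₂)
open import Function using (_∘_; _⇔_; mk⇔; Equivalence)
open import Relation.Binary.PropositionalEquality using (_≡_; _≗_; refl; sym; trans; cong; cong₂; subst; module ≡-Reasoning)

open ≡-Reasoning

-- Polynomials are compared through their coefficient sequences; shift n and
-- mul1+q^ n multiply a coefficient sequence by q^n and by 1 + q^n.

coeffs : Poly → ℕ → ℕ
coeffs p k = coeff k p

shift : ℕ → (ℕ → ℕ) → ℕ → ℕ
shift zero    f k       = f k
shift (suc n) f zero    = 0
shift (suc n) f (suc k) = shift n f k

mul1+q^ : ℕ → (ℕ → ℕ) → ℕ → ℕ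
mul1+q^ n f k = f k + shift n f k

shift-cong : ∀ n {f g} → f ≗ g → shift n f ≗ shift n g
shift-cong zero    f≗g k       = f≗g k
shift-cong (suc n) f≗g zero    = refl
shift-cong (suc n) f≗g (suc k) = shift-cong n f≗g k

shift-zero : ∀ n → shift n (λ _ → 0) ≗ (λ _ → 0)
shift-zero zero    k       = refl
shift-zero (suc n) zero    = refl
shift-zero (suc n) (suc k) = shift-zero n k

shift-+ : ∀ n f g → shift n (λ k → f k + g k) ≗ (λ k → shift n f k + shift n g k)
shift-+ zero    f g k       = refl
shift-+ (suc n) f g zero    = refl
shift-+ (suc n) f g (suc k) = shift-+ n f g k

shift-shift : ∀ m n f → shift m (shift n f) ≗ shift (m + n) f
shift-shift zero    n f k       = refl
shift-shift (suc m) n f zero    = refl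
shift-shift (suc m) n f (suc k) = shift-shift m n f k

shift-comm : ∀ m n f → shift m (shift n f) ≗ shift n (shift m f)
shift-comm m n f k = begin
  shift m (shift n f) k  ≡⟨ shift-shift m n f k ⟩
  shift (m + n) f k      ≡⟨ cong (λ i → shift i f k) (+-comm m n) ⟩
  shift (n + m) f k      ≡⟨ shift-shift n m f k ⟨
  shift n (shift m f) k  ∎

mul1+q^-cong : ∀ n {f g} → f ≗ g → mul1+q^ n f ≗ mul1+q^ n g
mul1+q^-cong n f≗g k = cong₂ _+_ (f≗g k) (shift-cong n f≗g k)

mul1+q^-comm : ∀ m n f → mul1+q^ m (mul1+q^ n f) ≗ mul1+q^ n (mul1+q^ m f)
mul1+q^-comm m n f k = begin
  (f k + shift n f k) + shift m (mul1+q^ n f) k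
    ≡⟨ cong (f k + shift n f k +_) (shift-+ m f (shift n f) k) ⟩
  (f k + shift n f k) + (shift m f k + shift m (shift n f) k)
    ≡⟨ cong (λ x → f k + shift n f k + (shift m f k + x)) (shift-comm m n f k) ⟩
  (f k + shift n f k) + (shift m f k + shift n (shift m f) k)
    ≡⟨ interchange (f k) (shift n f k) (shift m f k) (shift n (shift m f) k) ⟩
  (f k + shift m f k) + (shift n f k + shift n (shift m f) k)
    ≡⟨ cong (f k + shift m f k +_) (shift-+ n f (shift m f) k) ⟨
  (f k + shift m f k) + shift n (mul1+q^ m f) k
    ∎

coeff-addP : ∀ p r k → coeff k (addP p r) ≡ coeff k p + coeff k r
coeff-addP []      r       k       = refl
coeff-addP (a ∷ p) []      k       = sym (+-identityʳ _)
coeff-addP (a ∷ p) (b ∷ r) zero    = refl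
coeff-addP (a ∷ p) (b ∷ r) (suc k) = coeff-addP p r k

coeff-map-* : ∀ a p k → coeff k (map (a *_) p) ≡ a * coeff k p
coeff-map-* a []      k       = sym (*-zeroʳ a)
coeff-map-* a (b ∷ p) zero    = refl
coeff-map-* a (b ∷ p) (suc k) = coeff-map-* a p k

coeff-0∷ : ∀ p → coeffs (0 ∷ p) ≗ shift 1 (coeffs p)
coeff-0∷ p zero    = refl
coeff-0∷ p (suc k) = refl

coeff-mulP-∷ : ∀ a p r k → coeff k (mulP (a ∷ p) r) ≡ a * coeff k r + shift 1 (coeffs (mulP p r)) k
coeff-mulP-∷ a p r k =
  trans (coeff-addP (map (a *_) r) (0 ∷ mulP p r) k) (cong₂ _+_ (coeff-map-* a r k) (coeff-0∷ (mulP p r) k))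

coeff-mulP-qPow : ∀ n p → coeffs (mulP (qPow n) p) ≗ shift n (coeffs p)
coeff-mulP-qPow zero p k = begin
  coeff k (mulP oneP p)                ≡⟨ coeff-mulP-∷ 1 [] p k ⟩
  1 * coeff k p + shift 1 (λ _ → 0) k  ≡⟨ cong₂ _+_ (*-identityˡ _) (shift-zero 1 k) ⟩
  coeff k p + 0                        ≡⟨ +-identityʳ _ ⟩
  coeff k p                            ∎
coeff-mulP-qPow (suc n) p k = begin
  coeff k (mulP (0 ∷ qPow n) p)         ≡⟨ coeff-mulP-∷ 0 (qPow n) p k ⟩
  shift 1 (coeffs (mulP (qPow n) p)) k  ≡⟨ shift-cong 1 (coeff-mulP-qPow n p) k ⟩
  shift 1 (shift n (coeffs p)) k        ≡⟨ shift-shift 1 n (coeffs p) k ⟩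
  shift (suc n) (coeffs p) k            ∎

coeff-mulP-1+qPow : ∀ n p → coeffs (mulP (addP oneP (qPow (suc n))) p) ≗ mul1+q^ (suc n) (coeffs p)
coeff-mulP-1+qPow n p k = begin
  coeff k (mulP (1 ∷ qPow n) p)
    ≡⟨ coeff-mulP-∷ 1 (qPow n) p k ⟩
  1 * coeff k p + shift 1 (coeffs (mulP (qPow n) p)) k
    ≡⟨ cong₂ _+_ (*-identityˡ _) (shift-cong 1 (coeff-mulP-qPow n p) k) ⟩
  coeff k p + shift 1 (shift n (coeffs p)) k
    ≡⟨ cong (coeff k p +_) (shift-shift 1 n (coeffs p) k) ⟩
  mul1+q^ (suc n) (coeffs p) k
    ∎

prodRange : ℕ → ℕ → Poly
prodRange a m = prodP (map (λ j → addP oneP (qPow j)) (range a m))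

coeff-prodRange-suc : ∀ a m →
  coeffs (prodRange (suc a) (suc m)) ≗ mul1+q^ (suc (a + m)) (coeffs (prodRange (suc a) m))
coeff-prodRange-suc a zero k rewrite +-identityʳ a = coeff-mulP-1+qPow a oneP k
coeff-prodRange-suc a (suc m) k = begin
  coeffs (prodRange (suc a) (suc (suc m))) k
    ≡⟨ coeff-mulP-1+qPow a (prodRange (suc (suc a)) (suc m)) k ⟩
  mul1+q^ (suc a) (coeffs (prodRange (suc (suc a)) (suc m))) k
    ≡⟨ mul1+q^-cong (suc a) (coeff-prodRange-suc (suc a) m) k ⟩
  mul1+q^ (suc a) (mul1+q^ (suc (suc a + m)) Q) k
    ≡⟨ mul1+q^-comm (suc a) (suc (suc a + m)) Q k ⟩
  mul1+q^ (suc (suc a + m)) (mul1+q^ (suc a) Q) k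
    ≡⟨ mul1+q^-cong (suc (suc a + m)) (λ j → sym (coeff-mulP-1+qPow a (prodRange (suc (suc a)) m) j)) k ⟩
  mul1+q^ (suc (suc (a + m))) (coeffs (prodRange (suc a) (suc m))) k
    ≡⟨ cong (λ i → mul1+q^ (suc i) (coeffs (prodRange (suc a) (suc m))) k) (+-suc a m) ⟨
  mul1+q^ (suc (a + suc m)) (coeffs (prodRange (suc a) (suc m))) k
    ∎
  where
  Q = coeffs (prodRange (suc (suc a)) m)

coeff-qPow-+ : ∀ m n → coeffs (qPow (m + n)) ≗ shift m (coeffs (qPow n))
coeff-qPow-+ zero    n k       = refl
coeff-qPow-+ (suc m) n zero    = refl
coeff-qPow-+ (suc m) n (suc k) = coeff-qPow-+ m n k

coeff-sumP-map : ∀ {A : Set} (f : A → Poly) xs k →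
                 coeff k (sumP (map f xs)) ≡ sum (map (λ x → coeff k (f x)) xs)
coeff-sumP-map f []       k = refl
coeff-sumP-map f (x ∷ xs) k =
  trans (coeff-addP (f x) (sumP (map f xs)) k) (cong (coeff k (f x) +_) (coeff-sumP-map f xs k))

-- Inversion generating functions

invCount : List (List ℕ) → ℕ → ℕ
invCount L k = sum (map (λ π → coeff k (qPow (inv π))) L)

invCount-↭ : ∀ {L M} → L ↭ M → invCount L ≗ invCount M
invCount-↭ L↭M k = sum-↭ (↭.map⁺ _ L↭M)

invCount-++ : ∀ L M k → invCount (L ++ M) k ≡ invCount L k + invCount M k
invCount-++ L M k = trans (cong sum (map-++ weight L M)) (sum-++ (map weight L) (map weight M))
  where
  weight : List ℕ → ℕ
  weight π = coeff k (qPow (inv π))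

invCount-map : ∀ n f L → All (λ σ → inv (f σ) ≡ n + inv σ) L →
               invCount (map f L) ≗ shift n (invCount L)
invCount-map n f []      []       k = sym (shift-zero n k)
invCount-map n f (σ ∷ L) (e ∷ es) k = begin
  coeff k (qPow (inv (f σ))) + invCount (map f L) k
    ≡⟨ cong₂ _+_ (trans (cong (λ i → coeff k (qPow i)) e) (coeff-qPow-+ n (inv σ) k))
                 (invCount-map n f L es k) ⟩
  shift n (coeffs (qPow (inv σ))) k + shift n (invCount L) k
    ≡⟨ shift-+ n (coeffs (qPow (inv σ))) (invCount L) k ⟨
  shift n (invCount (σ ∷ L)) k
    ∎

count-map-suc : ∀ (p : ℕ → Bool) xs → countᵇ p (map suc xs) ≡ countᵇ (p ∘ suc) xs
count-map-suc p []       = refl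
count-map-suc p (x ∷ xs) with p (suc x)
... | true  = cong suc (count-map-suc p xs)
... | false = count-map-suc p xs

count-<ᵇ-≤ : ∀ {x xs} → All (x ≤_) xs → countᵇ (_<ᵇ x) xs ≡ 0
count-<ᵇ-≤ [] = refl
count-<ᵇ-≤ {x} {y ∷ xs} (x≤y ∷ x≤xs) with y <ᵇ x in y<ᵇx
... | true  = ⊥-elim (<⇒≱ (<ᵇ⇒< y x (Equivalence.from T-≡ y<ᵇx)) x≤y)
... | false = count-<ᵇ-≤ x≤xs

count-∷ʳ : ∀ (p : ℕ → Bool) xs {w} → T (p w) → countᵇ p (xs ∷ʳ w) ≡ suc (countᵇ p xs)
count-∷ʳ p [] t rewrite Equivalence.to T-≡ t = refl
count-∷ʳ p (x ∷ xs) t with p x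
... | true  = cong suc (count-∷ʳ p xs t)
... | false = count-∷ʳ p xs t

inv-map-suc : ∀ σ → inv (map suc σ) ≡ inv σ
inv-map-suc []      = refl
inv-map-suc (x ∷ σ) = cong₂ _+_ (count-map-suc (_<ᵇ suc x) σ) (inv-map-suc σ)

inv-∷-min : ∀ {x xs} → All (x ≤_) xs → inv (x ∷ xs) ≡ inv xs
inv-∷-min x≤xs = cong (_+ _) (count-<ᵇ-≤ x≤xs)

inv-∷ʳ-min : ∀ {w} xs → All (w <_) xs → inv (xs ∷ʳ w) ≡ length xs + inv xs
inv-∷ʳ-min []       []              = refl
inv-∷ʳ-min {w} (x ∷ xs) (w<x ∷ w<xs) = begin
  countᵇ (_<ᵇ x) (xs ∷ʳ w) + inv (xs ∷ʳ w)
    ≡⟨ cong₂ _+_ (count-∷ʳ (_<ᵇ x) xs (<⇒<ᵇ w<x)) (inv-∷ʳ-min xs w<xs) ⟩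
  suc (countᵇ (_<ᵇ x) xs + (length xs + inv xs))
    ≡⟨ cong suc (x∙yz≈y∙xz (countᵇ (_<ᵇ x) xs) (length xs) (inv xs)) ⟩
  suc (length xs + (countᵇ (_<ᵇ x) xs + inv xs))
    ∎

-- Permutations of a range

range-suc : ∀ a m → range (suc a) m ≡ map suc (range a m)
range-suc a zero    = refl
range-suc a (suc m) = cong (suc a ∷_) (range-suc (suc a) m)

length-range : ∀ a m → length (range a m) ≡ m
length-range a zero    = refl
length-range a (suc m) = cong suc (length-range (suc a) m)

≤-range : ∀ a m → All (a ≤_) (range a m)
≤-range a zero    = []
≤-range a (suc m) = ≤-refl ∷ All.map <⇒≤ (≤-range (suc a) m)

range-unique : ∀ a m → Unique (range a m)
range-unique a zero    = []
range-unique a (suc m) = All.map <⇒≢ (≤-range (suc a) m) ∷ range-unique (suc a) m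

↭-range-length : ∀ {a n π} → π ↭ range a n → length π ≡ n
↭-range-length {a} {n} π↭ = trans (↭.↭-length π↭) (length-range a n)

↭-range-≥ : ∀ {a n π} → π ↭ range a n → All (a ≤_) π
↭-range-≥ {a} {n} π↭ = ↭.All-resp-↭ (↭-sym π↭) (≤-range a n)

map-suc-↭-range : ∀ {n σ} → σ ↭ range 1 n → map suc σ ↭ range 2 n
map-suc-↭-range {n} σ↭ = subst (_ ↭_) (sym (range-suc 1 n)) (↭.map⁺ suc σ↭)

⊆∧length≤⇒↭ : ∀ {A : Set} {xs ys : List A} →
              Unique xs → xs ⊆ ys → length ys ≤ length xs → ys ↭ xs
⊆∧length≤⇒↭ {xs = []} {[]}    _ _ _ = ↭-refl
⊆∧length≤⇒↭ {xs = []} {_ ∷ _} _ _ ()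
⊆∧length≤⇒↭ {xs = x ∷ xs} (x∉xs ∷ xs-unique) xs⊆ys ys≤xs with ∈-∃++ (xs⊆ys (here refl))
... | as , bs , refl =
  ↭-trans (↭.shift x as bs) (↭-prep x (⊆∧length≤⇒↭ xs-unique xs⊆as++bs (s≤s⁻¹ as++bs<xs)))
  where
  xs⊆as++bs : xs ⊆ as ++ bs
  xs⊆as++bs v∈xs with ↭.∈-resp-↭ (↭.shift x as bs) (xs⊆ys (there v∈xs))
  ... | here v≡x = ⊥-elim (All.lookup x∉xs v∈xs (sym v≡x))
  ... | there v∈as++bs = v∈as++bs
  as++bs<xs : suc (length (as ++ bs)) ≤ suc (length xs)
  as++bs<xs = subst (_≤ suc (length xs)) (↭.↭-length (↭.shift x as bs)) ys≤xs

concatMap-prepend : ∀ {A : Set} (xs : List A) (yss : List (List A)) →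
                    concatMap (λ x → map (x ∷_) yss) xs ≡ cartesianProductWith _∷_ xs yss
concatMap-prepend []       yss = refl
concatMap-prepend (x ∷ xs) yss = cong (map (x ∷_) yss ++_) (concatMap-prepend xs yss)

seqs-suc : ∀ len xs → seqs (suc len) xs ≡ cartesianProductWith _∷_ xs (seqs len xs)
seqs-suc len xs = concatMap-prepend xs (seqs len xs)

seqs-unique : ∀ {xs} → Unique xs → ∀ len → Unique (seqs len xs)
seqs-unique xs-unique zero      = [] ∷ []
seqs-unique {xs} xs-unique (suc len) = subst Unique (sym (seqs-suc len xs))
  (Unique.cartesianProductWith⁺ _∷_ ∷-injective xs-unique (seqs-unique xs-unique len))

∈-seqs⁺ : ∀ {xs} π → All (_∈ xs) π → π ∈ seqs (length π) xs
∈-seqs⁺      []      []              = here refl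
∈-seqs⁺ {xs} (x ∷ π) (x∈xs ∷ π⊆xs) = subst (x ∷ π ∈_) (sym (seqs-suc (length π) xs))
  (∈-cartesianProductWith⁺ _∷_ x∈xs (∈-seqs⁺ π π⊆xs))

length-∈-seqs : ∀ len {xs π} → π ∈ seqs len xs → length π ≡ len
length-∈-seqs zero      (here refl) = refl
length-∈-seqs (suc len) {xs} π∈
  with _ , _ , _ , σ∈ , refl ←
         ∈-cartesianProductWith⁻ _∷_ xs (seqs len xs) (subst (_ ∈_) (seqs-suc len xs) π∈)
  = cong suc (length-∈-seqs len σ∈)

elemᵇ⇔∈ : ∀ {k π} → T (elemᵇ k π) ⇔ k ∈ π
elemᵇ⇔∈ {k} {π} = mk⇔
  (λ t → Any.map (≡ᵇ⇒≡ k _) (any⁻ (k ≡ᵇ_) π t))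
  (λ k∈π → any⁺ (k ≡ᵇ_) (Any.map (≡⇒≡ᵇ k _) k∈π))

coversᵇ⇔⊆ : ∀ {n π} → T (coversᵇ n π) ⇔ (range 1 n ⊆ π)
coversᵇ⇔⊆ {n} {π} = mk⇔
  (λ t {k} k∈ → Equivalence.to elemᵇ⇔∈ (All.lookup (Allₚ.all⁺ _ (range 1 n) t) k∈))
  (λ r⊆π → Allₚ.all⁻ _ (All.tabulate (λ k∈ → Equivalence.from elemᵇ⇔∈ (r⊆π k∈))))

∈-perms : ∀ n {π} → π ∈ perms n ⇔ (π ↭ range 1 n)
∈-perms n {π} = mk⇔ to from
  where
  to : π ∈ perms n → π ↭ range 1 n
  to π∈ with π∈seqs , covers ← ∈-filter⁻ (λ π → T? (coversᵇ n π)) π∈ =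
    ⊆∧length≤⇒↭ (range-unique 1 n) (Equivalence.to coversᵇ⇔⊆ covers)
      (≤-reflexive (trans (length-∈-seqs n π∈seqs) (sym (length-range 1 n))))
  from : π ↭ range 1 n → π ∈ perms n
  from π↭ = ∈-filter⁺ (λ π → T? (coversᵇ n π))
    (subst (λ l → π ∈ seqs l (range 1 n)) (trans (↭.↭-length π↭) (length-range 1 n))
      (∈-seqs⁺ π (All.tabulate (↭.∈-resp-↭ π↭))))
    (Equivalence.from coversᵇ⇔⊆ (↭.∈-resp-↭ (↭-sym π↭)))

-- Valleys

suc-≤ᵇ-suc : ∀ m n → (suc m ≤ᵇ suc n) ≡ (m ≤ᵇ n)
suc-≤ᵇ-suc zero    n = refl
suc-≤ᵇ-suc (suc m) n = refl

noValleyFrom-map-suc : ∀ x σ → noValleyFrom (suc x) (map suc σ) ≡ noValleyFrom x σ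
noValleyFrom-map-suc x []       = refl
noValleyFrom-map-suc x (y ∷ zs) = cong₂ _∧_
  (cong and (trans (sym (map-∘ zs)) (map-cong (λ z → suc-≤ᵇ-suc (x ⊓ z) y) zs)))
  (noValleyFrom-map-suc x zs)

valleylessᵇ-map-suc : ∀ σ → valleylessᵇ (map suc σ) ≡ valleylessᵇ σ
valleylessᵇ-map-suc []      = refl
valleylessᵇ-map-suc (x ∷ σ) = cong₂ _∧_ (noValleyFrom-map-suc x σ) (valleylessᵇ-map-suc σ)

noValleyFrom-min : ∀ {x ys} → All (x ≤_) ys → T (noValleyFrom x ys)
noValleyFrom-min [] = _
noValleyFrom-min {x} {y ∷ zs} (x≤y ∷ x≤zs) = Equivalence.from T-∧
  ( Allₚ.all⁻ _ (All.universal (λ z → ≤⇒≤ᵇ (≤-trans (m⊓n≤m x z) x≤y)) zs)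
  , noValleyFrom-min x≤zs )

valleylessᵇ-∷-min : ∀ {x xs} → All (x ≤_) xs → valleylessᵇ (x ∷ xs) ≡ valleylessᵇ xs
valleylessᵇ-∷-min {xs = xs} x≤xs = cong (_∧ valleylessᵇ xs) (Equivalence.to T-≡ (noValleyFrom-min x≤xs))

all-∷ʳ : ∀ {A : Set} (p : A → Bool) xs {w} → T (p w) → all p (xs ∷ʳ w) ≡ all p xs
all-∷ʳ p []       t rewrite Equivalence.to T-≡ t = refl
all-∷ʳ p (x ∷ xs) t = cong (p x ∧_) (all-∷ʳ p xs t)

noValleyFrom-∷ʳ-min : ∀ x {w} ys → All (w ≤_) ys → noValleyFrom x (ys ∷ʳ w) ≡ noValleyFrom x ys
noValleyFrom-∷ʳ-min x     []       []             = refl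
noValleyFrom-∷ʳ-min x {w} (y ∷ ys) (w≤y ∷ w≤ys) = cong₂ _∧_
  (all-∷ʳ _ ys (≤⇒≤ᵇ (≤-trans (m⊓n≤n x w) w≤y)))
  (noValleyFrom-∷ʳ-min x ys w≤ys)

valleylessᵇ-∷ʳ-min : ∀ {w} xs → All (w ≤_) xs → valleylessᵇ (xs ∷ʳ w) ≡ valleylessᵇ xs
valleylessᵇ-∷ʳ-min []       []             = refl
valleylessᵇ-∷ʳ-min (x ∷ xs) (w≤x ∷ w≤xs) =
  cong₂ _∧_ (noValleyFrom-∷ʳ-min x xs w≤xs) (valleylessᵇ-∷ʳ-min xs w≤xs)

noValleyFrom-inner : ∀ {a b c zs} ys → T (noValleyFrom a (ys ++ b ∷ c ∷ zs)) → a ⊓ c ≤ b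
noValleyFrom-inner {a} {b} {c} [] t =
  ≤ᵇ⇒≤ (a ⊓ c) b (proj₁ (Equivalence.to T-∧ (proj₁ (Equivalence.to T-∧ t))))
noValleyFrom-inner (y ∷ ys) t = noValleyFrom-inner ys (proj₂ (Equivalence.to T-∧ t))

valleyless-inner : ∀ {a b c zs} ys → Valleyless (a ∷ ys ++ b ∷ c ∷ zs) → a ⊓ c ≤ b
valleyless-inner ys v = noValleyFrom-inner ys (proj₁ (Equivalence.to T-∧ v))

-- Valleyless permutations

IsValleylessPerm : ℕ → List ℕ → Set
IsValleylessPerm n π = π ↭ range 1 n × Valleyless π

∈-valleylessPerms : ∀ n {π} → π ∈ valleylessPerms n ⇔ IsValleylessPerm n π
∈-valleylessPerms n {π} = mk⇔
  (λ π∈ → let π∈perms , v = ∈-filter⁻ (λ π → T? (valleylessᵇ π)) π∈ in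
          Equivalence.to (∈-perms n) π∈perms , v)
  (λ (π↭ , v) → ∈-filter⁺ (λ π → T? (valleylessᵇ π)) (Equivalence.from (∈-perms n) π↭) v)

valleylessPerms-unique : ∀ n → Unique (valleylessPerms n)
valleylessPerms-unique n = Unique.filter⁺ _ (Unique.filter⁺ _ (seqs-unique (range-unique 1 n) n))

consOne snocOne : List ℕ → List ℕ
consOne σ = 1 ∷ map suc σ
snocOne σ = map suc σ ∷ʳ 1

consOne-injective : ∀ {σ τ} → consOne σ ≡ consOne τ → σ ≡ τ
consOne-injective e = map-injective suc-injective (∷-injectiveʳ e)

snocOne-injective : ∀ {σ τ} → snocOne σ ≡ snocOne τ → σ ≡ τ
snocOne-injective {σ} {τ} e = map-injective suc-injective (∷ʳ-injectiveˡ (map suc σ) (map suc τ) e)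

consOne≡snocOne⇒[] : ∀ {σ τ} → consOne σ ≡ snocOne τ → All (1 ≤_) τ → τ ≡ []
consOne≡snocOne⇒[] {τ = []} _ _ = refl
consOne≡snocOne⇒[] {τ = zero ∷ τ}  _ (() ∷ _)
consOne≡snocOne⇒[] {τ = suc t ∷ τ} e _ with () ← ∷-injectiveˡ e

1≤map-suc : ∀ σ → All (1 ≤_) (map suc σ)
1≤map-suc σ = Allₚ.map⁺ (All.universal (λ _ → s≤s z≤n) σ)

inv-consOne : ∀ σ → inv (consOne σ) ≡ inv σ
inv-consOne σ = trans (inv-∷-min (1≤map-suc σ)) (inv-map-suc σ)

inv-snocOne : ∀ {σ} → All (1 ≤_) σ → inv (snocOne σ) ≡ length σ + inv σ
inv-snocOne {σ} 1≤σ = begin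
  inv (map suc σ ∷ʳ 1)                ≡⟨ inv-∷ʳ-min (map suc σ) (Allₚ.map⁺ (All.map s≤s 1≤σ)) ⟩
  length (map suc σ) + inv (map suc σ) ≡⟨ cong₂ _+_ (length-map suc σ) (inv-map-suc σ) ⟩
  length σ + inv σ                     ∎

valleylessᵇ-consOne : ∀ σ → valleylessᵇ (consOne σ) ≡ valleylessᵇ σ
valleylessᵇ-consOne σ = trans (valleylessᵇ-∷-min (1≤map-suc σ)) (valleylessᵇ-map-suc σ)

valleylessᵇ-snocOne : ∀ σ → valleylessᵇ (snocOne σ) ≡ valleylessᵇ σ
valleylessᵇ-snocOne σ = trans (valleylessᵇ-∷ʳ-min (map suc σ) (1≤map-suc σ)) (valleylessᵇ-map-suc σ)

consOne-valleylessPerm : ∀ {n σ} → IsValleylessPerm n σ → IsValleylessPerm (suc n) (consOne σ)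
consOne-valleylessPerm {σ = σ} (σ↭ , v) =
  ↭-prep 1 (map-suc-↭-range σ↭) , subst T (sym (valleylessᵇ-consOne σ)) v

snocOne-valleylessPerm : ∀ {n σ} → IsValleylessPerm n σ → IsValleylessPerm (suc n) (snocOne σ)
snocOne-valleylessPerm {σ = σ} (σ↭ , v) =
  ↭-trans (↭-sym (↭.∷↭∷ʳ 1 (map suc σ))) (↭-prep 1 (map-suc-↭-range σ↭)) ,
  subst T (sym (valleylessᵇ-snocOne σ)) v

remove-one : ∀ {n} ys zs → ys ++ 1 ∷ zs ↭ range 1 (suc n) → ys ++ zs ↭ map suc (range 1 n)
remove-one {n} ys zs π↭ = ↭.drop-∷
  (↭-trans (↭-sym (↭.shift 1 ys zs)) (subst (λ r → _ ↭ 1 ∷ r) (range-suc 1 n) π↭))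

peel-one-at : ∀ {n} ys zs → IsValleylessPerm (suc n) (ys ++ 1 ∷ zs) →
              ∃[ σ ] IsValleylessPerm n σ × (ys ++ 1 ∷ zs ≡ consOne σ ⊎ ys ++ 1 ∷ zs ≡ snocOne σ)
peel-one-at [] zs (π↭ , v)
  with σ , refl , r↭σ ← ↭.↭-map-inv suc (↭-sym (remove-one [] zs π↭)) =
  σ , (↭-sym r↭σ , subst T (valleylessᵇ-consOne σ) v) , inj₁ refl
peel-one-at {n} (y ∷ ys) [] (π↭ , v)
  with σ , e , r↭σ ← ↭.↭-map-inv suc
         (↭-sym (subst (_↭ map suc (range 1 n)) (++-identityʳ (y ∷ ys)) (remove-one (y ∷ ys) [] π↭))) =
  σ , (↭-sym r↭σ , subst T (trans (cong (λ l → valleylessᵇ (l ∷ʳ 1)) e) (valleylessᵇ-snocOne σ)) v)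
    , inj₂ (cong (_∷ʳ 1) e)
peel-one-at (y ∷ ys) (z ∷ zs) (π↭ , v)
  with σ , e , r↭σ ← ↭.↭-map-inv suc (↭-sym (remove-one (y ∷ ys) (z ∷ zs) π↭)) =
  ⊥-elim (1+n≰n (≤-trans (⊓-glb 2≤y 2≤z) (valleyless-inner ys v)))
  where
  2≤rest : All (2 ≤_) (y ∷ ys ++ z ∷ zs)
  2≤rest = subst (All (2 ≤_)) (sym e) (Allₚ.map⁺ (All.map s≤s (↭-range-≥ (↭-sym r↭σ))))
  2≤y : 2 ≤ y
  2≤y = All.head 2≤rest
  2≤z : 2 ≤ z
  2≤z = All.head (Allₚ.++⁻ʳ ys (All.tail 2≤rest))

peel-one : ∀ {n π} → IsValleylessPerm (suc n) π →
           ∃[ σ ] IsValleylessPerm n σ × (π ≡ consOne σ ⊎ π ≡ snocOne σ)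
peel-one (π↭ , v) with ys , zs , refl ← ∈-∃++ (↭.∈-resp-↭ (↭-sym π↭) (here refl)) =
  peel-one-at ys zs (π↭ , v)

valleylessPerms-suc : ∀ m → valleylessPerms (suc (suc m)) ↭
                            map consOne (valleylessPerms (suc m)) ++ map snocOne (valleylessPerms (suc m))
valleylessPerms-suc m =
  ∼bag⇒↭ (unique∧set⇒bag (valleylessPerms-unique (suc (suc m))) extensions-unique (mk⇔ to from))
  where
  V = valleylessPerms (suc m)
  ∈V = ∈-valleylessPerms (suc m)
  ∈V⁺ = ∈-valleylessPerms (suc (suc m))

  to : ∀ {π} → π ∈ valleylessPerms (suc (suc m)) → π ∈ map consOne V ++ map snocOne V
  to π∈ with peel-one (Equivalence.to ∈V⁺ π∈)
  ... | σ , σ-vp , inj₁ refl = ∈-++⁺ˡ (∈-map⁺ consOne (Equivalence.from ∈V σ-vp))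
  ... | σ , σ-vp , inj₂ refl = ∈-++⁺ʳ (map consOne V) (∈-map⁺ snocOne (Equivalence.from ∈V σ-vp))

  from : ∀ {π} → π ∈ map consOne V ++ map snocOne V → π ∈ valleylessPerms (suc (suc m))
  from π∈ with ∈-++⁻ (map consOne V) π∈
  ... | inj₁ π∈cons with σ , σ∈ , refl ← ∈-map⁻ consOne π∈cons =
    Equivalence.from ∈V⁺ (consOne-valleylessPerm (Equivalence.to ∈V σ∈))
  ... | inj₂ π∈snoc with σ , σ∈ , refl ← ∈-map⁻ snocOne π∈snoc =
    Equivalence.from ∈V⁺ (snocOne-valleylessPerm (Equivalence.to ∈V σ∈))

  disjoint : Disjoint (map consOne V) (map snocOne V)
  disjoint (π∈cons , π∈snoc)
    with σ , _ , refl ← ∈-map⁻ consOne π∈cons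
    with τ , τ∈ , e ← ∈-map⁻ snocOne π∈snoc =
    let τ↭ , _ = Equivalence.to ∈V τ∈ in
    0≢1+n (trans (cong length (sym (consOne≡snocOne⇒[] e (↭-range-≥ τ↭)))) (↭-range-length τ↭))

  extensions-unique : Unique (map consOne V ++ map snocOne V)
  extensions-unique = Unique.++⁺ (Unique.map⁺ consOne-injective (valleylessPerms-unique (suc m)))
                                 (Unique.map⁺ snocOne-injective (valleylessPerms-unique (suc m)))
                                 disjoint

invCount-valleylessPerms-suc : ∀ m →
  invCount (valleylessPerms (suc (suc m))) ≗ mul1+q^ (suc m) (invCount (valleylessPerms (suc m)))
invCount-valleylessPerms-suc m k = begin
  invCount (valleylessPerms (suc (suc m))) k
    ≡⟨ invCount-↭ (valleylessPerms-suc m) k ⟩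
  invCount (map consOne V ++ map snocOne V) k
    ≡⟨ invCount-++ (map consOne V) (map snocOne V) k ⟩
  invCount (map consOne V) k + invCount (map snocOne V) k
    ≡⟨ cong₂ _+_ (invCount-map 0 consOne V (All.universal inv-consOne V) k)
                 (invCount-map (suc m) snocOne V (All.tabulate inv-snocOne-V) k) ⟩
  mul1+q^ (suc m) (invCount V) k
    ∎
  where
  V = valleylessPerms (suc m)
  inv-snocOne-V : ∀ {σ} → σ ∈ V → inv (snocOne σ) ≡ suc m + inv σ
  inv-snocOne-V {σ} σ∈ = let σ↭ , _ = Equivalence.to (∈-valleylessPerms (suc m)) σ∈ in
    trans (inv-snocOne (↭-range-≥ σ↭)) (cong (_+ inv σ) (↭-range-length σ↭))

invCount≗coeffs-rhsPoly : ∀ m → invCount (valleylessPerms (suc m)) ≗ coeffs (rhsPoly (suc m))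
-- valleylessPerms 1 evaluates to [ [ 1 ] ].
invCount≗coeffs-rhsPoly zero    k = +-identityʳ (coeff k oneP)
invCount≗coeffs-rhsPoly (suc m) k = begin
  invCount (valleylessPerms (suc (suc m))) k
    ≡⟨ invCount-valleylessPerms-suc m k ⟩
  mul1+q^ (suc m) (invCount (valleylessPerms (suc m))) k
    ≡⟨ mul1+q^-cong (suc m) (invCount≗coeffs-rhsPoly m) k ⟩
  mul1+q^ (suc m) (coeffs (rhsPoly (suc m))) k
    ≡⟨ coeff-prodRange-suc 0 m k ⟨
  coeffs (rhsPoly (suc (suc m))) k
    ∎

corollary1 : (n : ℕ) → 1 ≤ n → (k : ℕ) → coeff k (lhsPoly n) ≡ coeff k (rhsPoly n)
corollary1 zero    () k
corollary1 (suc m) _  k =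
  trans (coeff-sumP-map (λ π → qPow (inv π)) (valleylessPerms (suc m)) k) (invCount≗coeffs-rhsPoly m k)
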